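{- Let $G=(V,A)$ be an Eulerian digraph, $s_1\neq s_2$ vertices, and $\mathcal{C}_1$ the set of recurrent configurations with respect to sink $s_1$. If $c,c'\in\mathcal{C}_1$ satisfy $c(v)\le c'(v)$ for all $v\ne s_1$, then $\mathcal{I}_{s_2}(c)\le\mathcal{I}_{s_2}(c')$.
   Context: All digraphs are finite multi-digraphs without loops; $\deg_G(u,w)$ is the number of arcs from $u$ to $w$, $\deg^\pm_G$ out/in-degree. $G$ is Eulerian if connected and $\deg^-_G(v)=\deg^+_G(v)$ for all $v$. Chip-firing game with sink $s$: configurations are maps $c:V\setminus\{s\}\to\mathbb{N}$; $v\neq s$ is firable if $c(v)\ge\deg^+_G(v)$; firing $v$ decreases $c(v)$ by $\deg^+_G(v)$ and increases $c(w)$ by $\deg_G(v,w)$ for $w\notin\{v,s\}$; $s$ never fires. Repeated firing gives a unique stable configuration $c^\circ$. A stable $c$ is recurrent if for every configuration $d$ there is a configuration $d'$ with $(d+d')^\circ=c$. For a map $x:V\to\mathbb{N}$ and a vertex $s$, $x^{\circ s}:V\to\mathbb{N}$ is obtained by repeatedly firing vertices $v\ne s$ with $x(v)\ge\deg^+_G(v)$, where firing $v$ decreases $x(v)$ by $\deg^+_G(v)$ and increases $x(w)$ by $\deg_G(v,w)$ for every $w\ne v$ (including $w=s$; chips on $s$ are kept), until no vertex other than $s$ is firable; this is well defined. For a configuration $c:V\setminus\{s_1\}\to\mathbb{N}$ and $i\in\mathbb{N}$, $\overline{c}^{\,i}:V\to\mathbb{N}$ equals $c$ on $V\setminus\{s_1\}$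 and $\deg^+_G(s_1)+i$ at $s_1$. For $c\in\mathcal{C}_1$, the swap number $\mathcal{I}_{s_2}(c)$ is the smallest $i\in\mathbb{N}$ with $\left(\overline{c}^{\,i}\right)^{\circ s_2}(s_2)=\deg^+_G(s_2)+i$ (such $i$ always exists). -}

module Defs where

open import Data.Nat using (ℕ; _+_; _∸_; _≤_; _<_)
open import Data.Fin using (Fin; _≟_)
open import Data.List using (List; map; allFin)
open import Data.Nat.ListAction using (sum)
open import Data.Product using (Σ; _×_; ∃; _,_)
open import Data.Sum using (_⊎_)
open import Relation.Nullary using (¬_; yes; no)
open import Relation.Binary.PropositionalEquality using (_≡_; _≢_)

-- A finite multi-digraph without loops on the vertex set Fin n.
-- deg u w = number of arcs from u to w.
record Digraph (n : ℕ) : Set where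
  field
    deg    : Fin n → Fin n → ℕ
    noLoop : ∀ v → deg v v ≡ 0
open Digraph public

module _ {n : ℕ} (G : Digraph n) where

  outdeg : Fin n → ℕ
  outdeg v = sum (map (λ w → deg G v w) (allFin n))

  indeg : Fin n → ℕ
  indeg v = sum (map (λ u → deg G u v) (allFin n))

  -- (weak) connectivity: reachability in the underlying undirected graph
  data Reach : Fin n → Fin n → Set where
    here : ∀ {u} → Reach u u
    step : ∀ {u v w} → (0 < deg G u v ⊎ 0 < deg G v u) → Reach v w → Reach u w

  Connected : Set
  Connected = ∀ u w → Reach u w

  Eulerian : Set
  Eulerian = Connected × (∀ v → indeg v ≡ outdeg v)

  -- firing vertex v in a chip map x : V → ℕ (all other vertices, including
  -- the sink, receive deg v w chips)
  fire : Fin n → (Fin n → ℕ) → (Fin n → ℕ)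
  fire v x w with w ≟ v
  ... | yes _ = x w ∸ outdeg v
  ... | no  _ = x w + deg G v w

  data Fires (s : Fin n) : (Fin n → ℕ) → (Fin n → ℕ) → Set where
    done : ∀ {x} → Fires s x x
    fire-step : ∀ {x y} v → v ≢ s → outdeg v ≤ x v → Fires s (fire v x) y → Fires s x y

  Stable : Fin n → (Fin n → ℕ) → Set
  Stable s x = ∀ v → v ≢ s → x v < outdeg v

  -- y is the stabilization x^{∘s} of x (unique, by the paper's well-definedness)
  Stabilizes : Fin n → (Fin n → ℕ) → (Fin n → ℕ) → Set
  Stabilizes s x y = Fires s x y × Stable s y

  -- Configurations w.r.t. sink s are represented by maps Fin n → ℕ whose
  -- value at s is ignored; they are compared only off s.
  AgreeOff : Fin n → (Fin n → ℕ) → (Fin n → ℕ) → Set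
  AgreeOff s x y = ∀ v → v ≢ s → x v ≡ y v

  Recurrent : Fin n → (Fin n → ℕ) → Set
  Recurrent s c = Stable s c ×
    (∀ (d : Fin n → ℕ) → ∃ λ (d' : Fin n → ℕ) → ∃ λ (e : Fin n → ℕ) →
       Stabilizes s (λ v → d v + d' v) e × AgreeOff s e c)

  bar : Fin n → (Fin n → ℕ) → ℕ → (Fin n → ℕ)
  bar s₁ c i v with v ≟ s₁
  ... | yes _ = outdeg s₁ + i
  ... | no  _ = c v

  SwapCond : Fin n → Fin n → (Fin n → ℕ) → ℕ → Set
  SwapCond s₁ s₂ c i = ∃ λ (y : Fin n → ℕ) →
    Stabilizes s₂ (bar s₁ c i) y × y s₂ ≡ outdeg s₂ + i

  IsSwapNumber : Fin n → Fin n → (Fin n → ℕ) → ℕ → Set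
  IsSwapNumber s₁ s₂ c i = SwapCond s₁ s₂ c i × (∀ j → j < i → ¬ SwapCond s₁ s₂ c j)

-- Let c ≤ c' be recurrent for sink s₁, with swap numbers i and i', and suppose
-- i' < i.  Since the swap condition fails for c at every j ≤ i', stabilizing
-- \overline{c}^j for sink s₂ leaves strictly more than outdeg s₂ + j chips on
-- s₂ (the "overshoot"): for j = 0 this is the burning algorithm (recurrence
-- of c lets every vertex fire once, loading s₂), and passing from j to j + 1
-- never removes chips from s₂.  But \overline{c}^{i'} ≤ \overline{c'}^{i'},
-- whose stabilization leaves exactly outdeg s₂ + i' chips on s₂, and by the
-- least action principle the smaller configuration sends no more chips to s₂.
module Submission where

open import Defs
open import Data.Nat using (ℕ; zero; suc; _+_; _*_; _∸_; _≤_; _<_; z≤n; s≤s; _≤?_)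
  renaming (_≟_ to _≟ℕ_)
open import Data.Nat.Properties hiding (_≟_)
open import Data.Nat.ListAction using (sum)
open import Data.Fin using (Fin; zero; suc; _≟_)
open import Data.Fin.Properties using (any?)
open import Data.List using (map; allFin)
open import Data.List.Properties using (map-tabulate; map-cong)
open import Data.Product using (∃; _×_; _,_; proj₂)
open import Data.Sum using (inj₁; inj₂)
open import Data.Empty using (⊥; ⊥-elim)
open import Function using (_∘_; id)
open import Relation.Nullary using (¬_; yes; no)
open import Relation.Nullary.Negation using (contradiction)
open import Relation.Nullary.Decidable using (¬?; _×-dec_)
open import Relation.Binary.PropositionalEquality
open import Algebra.Properties.CommutativeSemigroup +-commutativeSemigroup
  using (interchange; x∙yz≈xz∙y; xy∙z≈xz∙y)

Σ : ∀ {n} → (Fin n → ℕ) → ℕ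
Σ {n} f = sum (map f (allFin n))

Σ-unfold : ∀ {n} (f : Fin (suc n) → ℕ) → Σ f ≡ f zero + Σ (f ∘ suc)
Σ-unfold {n} f =
  cong (λ xs → f zero + sum xs) (trans (map-tabulate suc f) (sym (map-tabulate id (f ∘ suc))))

Σ-cong : ∀ {n} {f g : Fin n → ℕ} → (∀ u → f u ≡ g u) → Σ f ≡ Σ g
Σ-cong {n} f≗g = cong sum (map-cong f≗g (allFin n))

Σ-mono : ∀ {n} {f g : Fin n → ℕ} → (∀ u → f u ≤ g u) → Σ f ≤ Σ g
Σ-mono {zero}          _   = z≤n
Σ-mono {suc n} {f} {g} f≤g =
  subst₂ _≤_ (sym (Σ-unfold f)) (sym (Σ-unfold g)) (+-mono-≤ (f≤g zero) (Σ-mono (f≤g ∘ suc)))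

Σ-zero : ∀ n → Σ {n} (λ _ → 0) ≡ 0
Σ-zero zero    = refl
Σ-zero (suc n) = trans (Σ-unfold {n} (λ _ → 0)) (Σ-zero n)

Σ-+ : ∀ {n} (f g : Fin n → ℕ) → Σ (λ u → f u + g u) ≡ Σ f + Σ g
Σ-+ {zero}  f g = refl
Σ-+ {suc n} f g = begin
  Σ (λ u → f u + g u)
    ≡⟨ Σ-unfold (λ u → f u + g u) ⟩
  (f zero + g zero) + Σ (λ u → f (suc u) + g (suc u))
    ≡⟨ cong ((f zero + g zero) +_) (Σ-+ (f ∘ suc) (g ∘ suc)) ⟩
  (f zero + g zero) + (Σ (f ∘ suc) + Σ (g ∘ suc))
    ≡⟨ interchange (f zero) (g zero) _ _ ⟩
  (f zero + Σ (f ∘ suc)) + (g zero + Σ (g ∘ suc))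
    ≡⟨ sym (cong₂ _+_ (Σ-unfold f) (Σ-unfold g)) ⟩
  Σ f + Σ g ∎
  where open ≡-Reasoning

-- The Kronecker delta: δ v is the indicator vector of the vertex v, i.e. the
-- odometer of a single firing of v.

δ : ∀ {n} → Fin n → Fin n → ℕ
δ zero    zero    = 1
δ zero    (suc _) = 0
δ (suc _) zero    = 0
δ (suc v) (suc u) = δ v u

δ-diag : ∀ {n} (v : Fin n) → δ v v ≡ 1
δ-diag zero    = refl
δ-diag (suc v) = δ-diag v

δ-off : ∀ {n} {v u : Fin n} → u ≢ v → δ v u ≡ 0
δ-off {v = zero}  {zero}  u≢v = ⊥-elim (u≢v refl)
δ-off {v = zero}  {suc u} _   = refl
δ-off {v = suc v} {zero}  _   = refl
δ-off {v = suc v} {suc u} u≢v = δ-off (u≢v ∘ cong suc)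

δ≤1 : ∀ {n} (v u : Fin n) → δ v u ≤ 1
δ≤1 zero    zero    = ≤-refl
δ≤1 zero    (suc _) = z≤n
δ≤1 (suc _) zero    = z≤n
δ≤1 (suc v) (suc u) = δ≤1 v u

Σ-δ-weight : ∀ {n} (v : Fin n) (g : Fin n → ℕ) → Σ (λ u → δ v u * g u) ≡ g v
Σ-δ-weight {suc n} zero g = begin
  Σ (λ u → δ zero u * g u)       ≡⟨ Σ-unfold (λ u → δ zero u * g u) ⟩
  (g zero + 0) + Σ {n} (λ _ → 0) ≡⟨ cong₂ _+_ (+-identityʳ (g zero)) (Σ-zero n) ⟩
  g zero + 0                     ≡⟨ +-identityʳ (g zero) ⟩
  g zero                         ∎
  where open ≡-Reasoning
Σ-δ-weight {suc n} (suc v) g = trans (Σ-unfold (λ u → δ (suc v) u * g u)) (Σ-δ-weight v (g ∘ suc))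

Σ-add-δ : ∀ {n} (a : Fin n → ℕ) (v : Fin n) → Σ (λ u → a u + δ v u) ≡ Σ a + 1
Σ-add-δ a v = trans (Σ-+ a (δ v))
  (cong (Σ a +_) (trans (Σ-cong (λ u → sym (*-identityʳ (δ v u)))) (Σ-δ-weight v (λ _ → 1))))

δ-step : ∀ {n} {a b : Fin n → ℕ} {v} → a v < b v → (∀ u → a u ≤ b u) →
  ∀ u → a u + δ v u ≤ b u
δ-step {a = a} {v = v} av<bv a≤b u with u ≟ v
... | yes refl rewrite δ-diag u | +-comm (a u) 1 = av<bv
... | no u≢v   rewrite δ-off u≢v | +-identityʳ (a u) = a≤b u

δ-keeps : ∀ {n} {a : Fin n → ℕ} {w u m} → u ≢ w → a u ≡ m → a u + δ w u ≡ m
δ-keeps {m = m} u≢w au≡m = trans (cong₂ _+_ au≡m (δ-off u≢w)) (+-identityʳ m)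

-- Termination bookkeeping for firing loops: while Σ a + k bounds Σ b, an
-- odometer a kept below b can take k further firings, and no more.
fuel-step : ∀ {n} {a b : Fin n → ℕ} {v k} →
  Σ b ≤ Σ a + suc k → Σ b ≤ Σ (λ u → a u + δ v u) + k
fuel-step {a = a} {v = v} {k} fuel =
  ≤-trans fuel (≤-reflexive (trans (sym (+-assoc (Σ a) 1 k)) (cong (_+ k) (sym (Σ-add-δ a v)))))

no-fuel : ∀ {n} {a b : Fin n → ℕ} {v} → Σ (λ u → a u + δ v u) ≤ Σ b → Σ b ≤ Σ a + 0 → ⊥
no-fuel {a = a} {v = v} grown fuel = 1+n≰n (begin
  1 + Σ a                ≡⟨ trans (+-comm 1 (Σ a)) (sym (Σ-add-δ a v)) ⟩
  Σ (λ u → a u + δ v u) ≤⟨ grown ⟩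
  _                      ≤⟨ fuel ⟩
  Σ a + 0                ≡⟨ +-identityʳ (Σ a) ⟩
  Σ a                    ∎)
  where open ≤-Reasoning

1∸m≡1⇒m≡0 : ∀ {m} → m ≤ 1 → 1 ∸ m ≡ 1 → m ≡ 0
1∸m≡1⇒m≡0 {zero}        _       _  = refl
1∸m≡1⇒m≡0 {suc zero}    _       ()
1∸m≡1⇒m≡0 {suc (suc _)} (s≤s ()) _

module _ {n : ℕ} (G : Digraph n) where

  private
    out : Fin n → ℕ
    out = outdeg G

  -- Odometers.  inflow a w is the number of chips w receives when every vertex
  -- u fires a u times; a is an odometer from x to y if firing according to a
  -- turns x into y, i.e. chips are conserved at every vertex.

  inflow : (Fin n → ℕ) → Fin n → ℕ
  inflow a w = Σ (λ u → a u * deg G u w)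

  record Odometer (x a y : Fin n → ℕ) : Set where
    constructor conserves
    field balance : ∀ w → y w + a w * out w ≡ x w + inflow a w
  open Odometer public

  inflow-+ : ∀ (a b : Fin n → ℕ) w → inflow (λ u → a u + b u) w ≡ inflow a w + inflow b w
  inflow-+ a b w = trans (Σ-cong (λ u → *-distribʳ-+ (deg G u w) (a u) (b u)))
    (Σ-+ (λ u → a u * deg G u w) (λ u → b u * deg G u w))

  -- Inflow is monotone in the odometer; since there are no loops, the value
  -- of the odometer at w itself is irrelevant.
  inflow-mono-off : ∀ {a b : Fin n → ℕ} {w} → (∀ u → u ≢ w → a u ≤ b u) → inflow a w ≤ inflow b w
  inflow-mono-off {a} {b} {w} a≤b = Σ-mono pointwise
    where
    pointwise : ∀ u → a u * deg G u w ≤ b u * deg G u w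
    pointwise u with u ≟ w
    ... | yes refl rewrite noLoop G u | *-zeroʳ (a u) = z≤n
    ... | no u≢w   = *-monoˡ-≤ (deg G u w) (a≤b u u≢w)

  indeg-split : ∀ (a : Fin n → ℕ) → (∀ u → a u ≤ 1) →
    ∀ w → indeg G w ≡ inflow (λ u → 1 ∸ a u) w + inflow a w
  indeg-split a a≤1 w = trans
    (Σ-cong (λ u → sym (trans (cong (_* deg G u w) (m∸n+n≡m (a≤1 u))) (*-identityˡ (deg G u w)))))
    (inflow-+ (λ u → 1 ∸ a u) a w)

  odometer-refl : ∀ {x} → Odometer x (λ _ → 0) x
  odometer-refl {x} = conserves λ w → cong (x w +_) (sym (Σ-zero n))

  odometer-trans : ∀ {x a y b z} → Odometer x a y → Odometer y b z → Odometer x (λ u → a u + b u) z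
  odometer-trans {x} {a} {y} {b} {z} xay ybz = conserves λ w → begin
    z w + (a w + b w) * out w         ≡⟨ cong (z w +_) (*-distribʳ-+ (out w) (a w) (b w)) ⟩
    z w + (a w * out w + b w * out w) ≡⟨ x∙yz≈xz∙y (z w) _ _ ⟩
    (z w + b w * out w) + a w * out w ≡⟨ cong (_+ a w * out w) (balance ybz w) ⟩
    (y w + inflow b w) + a w * out w  ≡⟨ xy∙z≈xz∙y (y w) _ _ ⟩
    (y w + a w * out w) + inflow b w  ≡⟨ cong (_+ inflow b w) (balance xay w) ⟩
    (x w + inflow a w) + inflow b w   ≡⟨ +-assoc (x w) _ _ ⟩
    x w + (inflow a w + inflow b w)   ≡⟨ cong (x w +_) (sym (inflow-+ a b w)) ⟩
    x w + inflow (λ u → a u + b u) w  ∎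
    where open ≡-Reasoning

  odometer-fire : ∀ {v z} → out v ≤ z v → Odometer z (δ v) (fire G v z)
  odometer-fire {v} {z} unstable = conserves λ w →
    trans (fire-balance w) (cong (z w +_) (sym (Σ-δ-weight v (λ u → deg G u w))))
    where
    fire-balance : ∀ w → fire G v z w + δ v w * out w ≡ z w + deg G v w
    fire-balance w with w ≟ v
    ... | yes refl rewrite δ-diag w | noLoop G w | +-identityʳ (out w) | +-identityʳ (z w) =
      m∸n+n≡m unstable
    ... | no w≢v   rewrite δ-off w≢v = +-identityʳ _

  firings : ∀ {s x y} → Fires G s x y → Fin n → ℕ
  firings done                 u = 0
  firings (fire-step v _ _ p) u = δ v u + firings p u

  odometer-firings : ∀ {s x y} (p : Fires G s x y) → Odometer x (firings p) y
  odometer-firings done                       = odometer-refl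
  odometer-firings (fire-step v _ unstable p) =
    odometer-trans (odometer-fire unstable) (odometer-firings p)

  firings-sink : ∀ {s x y} (p : Fires G s x y) → firings p s ≡ 0
  firings-sink done                    = refl
  firings-sink (fire-step v v≢s _ p) rewrite δ-off (v≢s ∘ sym) = firings-sink p

  idle-vertex : ∀ {s x y v} (p : Fires G s x y) → firings p v ≡ 0 → y v ≡ x v + inflow (firings p) v
  idle-vertex {x = x} {y} {v} p idle = begin
    y v                       ≡⟨ sym (+-identityʳ (y v)) ⟩
    y v + 0 * out v           ≡⟨ cong (λ t → y v + t * out v) (sym idle) ⟩
    y v + firings p v * out v ≡⟨ balance (odometer-firings p) v ⟩
    x v + inflow (firings p) v ∎
    where open ≡-Reasoning

  -- The sink never fires, so its chip count never decreases.
  sink-nondecreasing : ∀ {s x y} (p : Fires G s x y) → x s ≤ y s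
  sink-nondecreasing p = subst (_ ≤_) (sym (idle-vertex p (firings-sink p))) (m≤m+n _ _)

  _++ᶠ_ : ∀ {s x y z} → Fires G s x y → Fires G s y z → Fires G s x z
  done                      ++ᶠ q = q
  fire-step v v≢s unstable p ++ᶠ q = fire-step v v≢s unstable (p ++ᶠ q)

  module LeastAction {s : Fin n} {x x' y' : Fin n → ℕ}
      (x≤x' : ∀ w → x w ≤ x' w) (q : Fires G s x' y') (y'-stable : Stable G s y') where

    Below : (Fin n → ℕ) → Set
    Below a = ∀ u → a u ≤ firings q u

    -- While the odometer from x stays below that of q, each unstable non-sink
    -- vertex still has a firing to spare in q: otherwise it would hold at
    -- most as many chips as in the stable y'.
    spare-firing : ∀ {a z v} → Odometer x a z → Below a → v ≢ s → out v ≤ z v → a v < firings q v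
    spare-firing {a} {z} {v} xaz a≤q v≢s unstable with firings q v ≤? a v
    ... | no q≰a  = ≰⇒> q≰a
    ... | yes q≤a = contradiction (≤-trans unstable z≤y') (<⇒≱ (y'-stable v v≢s))
      where
      z≤y' : z v ≤ y' v
      z≤y' = +-cancelʳ-≤ _ _ _ (begin
        z v + a v * out v            ≡⟨ balance xaz v ⟩
        x v + inflow a v             ≤⟨ +-mono-≤ (x≤x' v) (inflow-mono-off (λ u _ → a≤q u)) ⟩
        x' v + inflow (firings q) v  ≡⟨ sym (balance (odometer-firings q) v) ⟩
        y' v + firings q v * out v   ≤⟨ +-monoʳ-≤ (y' v) (*-monoˡ-≤ (out v) q≤a) ⟩
        y' v + a v * out v           ∎)
        where open ≤-Reasoning

    least-action-from : ∀ {a z y} → Odometer x a z → Below a → (p : Fires G s z y) →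
      Below (λ u → a u + firings p u)
    least-action-from {a} xaz a≤q done u = subst (_≤ firings q u) (sym (+-identityʳ (a u))) (a≤q u)
    least-action-from {a} xaz a≤q (fire-step v v≢s unstable p) u =
      subst (_≤ firings q u) (+-assoc (a u) (δ v u) (firings p u))
        (least-action-from (odometer-trans xaz (odometer-fire unstable))
          (δ-step (spare-firing xaz a≤q v≢s unstable) a≤q) p u)

    least-action : ∀ {y} (p : Fires G s x y) → Below (firings p)
    least-action = least-action-from odometer-refl (λ _ → z≤n)

    -- Firing unstable vertices below q terminates, with Σ (firings q) as fuel.
    stabilize-within : ∀ k {a z} → Σ (firings q) ≤ Σ a + k → Odometer x a z → Below a →
      ∃ λ y → Stabilizes G s z y
    stabilize-within k {a} {z} fuel xaz a≤q with any? (λ v → ¬? (v ≟ s) ×-dec (out v ≤? z v))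
    ... | no none = z , done , λ v v≢s → ≰⇒> (λ unstable → none (v , v≢s , unstable))
    ... | yes (v , v≢s , unstable) = continue k fuel
      where
      fired≤q : Below (λ u → a u + δ v u)
      fired≤q = δ-step (spare-firing xaz a≤q v≢s unstable) a≤q
      continue : ∀ k → Σ (firings q) ≤ Σ a + k → ∃ λ y → Stabilizes G s z y
      continue zero    fuel = ⊥-elim (no-fuel {a = a} {b = firings q} {v = v} (Σ-mono fired≤q) fuel)
      continue (suc k) fuel
        with stabilize-within k (fuel-step {a = a} {b = firings q} {v = v} fuel)
               (odometer-trans xaz (odometer-fire unstable)) fired≤q
      ... | y , p , y-stable = y , fire-step v v≢s unstable p , y-stable

    stabilize-after : ∀ {z} → Fires G s x z → ∃ λ y → Stabilizes G s z y
    stabilize-after r =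
      stabilize-within (Σ (firings q)) (m≤n+m _ _) (odometer-firings r) (least-action r)

  sink-monotone : ∀ {s x x' y y'} → (∀ w → x w ≤ x' w) →
    (p : Fires G s x y) (q : Fires G s x' y') → Stable G s y' → y s ≤ y' s
  sink-monotone x≤x' p q y'-stable =
    subst₂ _≤_ (sym (idle-vertex p (firings-sink p))) (sym (idle-vertex q (firings-sink q)))
      (+-mono-≤ (x≤x' _) (inflow-mono-off (λ u _ → LeastAction.least-action x≤x' q y'-stable p u)))

  -- Vertex sets are indicator vectors χ (all values ≤ 1); inflow χ u counts
  -- the arcs from the set into u.

  members-still-fire : ∀ {v} (χ rest : Fin n → ℕ) → (∀ u → χ u ≤ 1) →
    (∀ u → χ u ≤ δ v u + rest u) → (χ v ≡ 1 → 0 < rest v) → ∀ u → χ u ≤ rest u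
  members-still-fire {v} χ rest χ≤1 χ≤all v-continues u with u ≟ v
  ... | no u≢v   = subst (λ t → χ u ≤ t + rest u) (δ-off u≢v) (χ≤all u)
  ... | yes refl with m≤n⇒m<n∨m≡n (χ≤1 u)
  ...   | inj₁ χu<1 = ≤-trans (≤-pred χu<1) z≤n
  ...   | inj₂ χu≡1 = subst (_≤ rest u) (sym χu≡1) (v-continues χu≡1)

  -- If all members of a nonempty set χ fire in p, the member that first
  -- fires for the last time afterwards receives a chip along every arc from
  -- the other members, so it ends with at least inflow χ chips.
  first-to-finish : ∀ {s z y} (p : Fires G s z y) (χ : Fin n → ℕ) → (∀ u → χ u ≤ 1) →
    (∀ u → χ u ≤ firings p u) → ∃ (λ u → χ u ≡ 1) → ∃ λ u → χ u ≡ 1 × inflow χ u ≤ y u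
  first-to-finish done χ _ χ≤p (u , χu≡1) = contradiction (subst (_≤ 0) χu≡1 (χ≤p u)) λ ()
  first-to-finish {y = y} (fire-step v _ _ p) χ χ≤1 χ≤p nonempty with firings p v in fires-again
  ... | suc _ = first-to-finish p χ χ≤1
        (members-still-fire χ (firings p) χ≤1 χ≤p (λ _ → subst (0 <_) (sym fires-again) (s≤s z≤n)))
        nonempty
  ... | zero with χ v ≟ℕ 1
  ...   | no χv≢1  = first-to-finish p χ χ≤1
          (members-still-fire χ (firings p) χ≤1 χ≤p (λ χv≡1 → contradiction χv≡1 χv≢1)) nonempty
  ...   | yes χv≡1 = v , χv≡1 , ≤-trans (inflow-mono-off others-fire)
          (subst (inflow (firings p) v ≤_) (sym (idle-vertex p fires-again)) (m≤n+m _ (fire G v _ v)))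
    where
    others-fire : ∀ u → u ≢ v → χ u ≤ firings p u
    others-fire u u≢v = subst (λ t → χ u ≤ t + firings p u) (δ-off u≢v) (χ≤p u)

  loaded-stabilization-fires : ∀ {s x e} (p : Fires G s x e) → Stable G s e →
    (∀ u → u ≢ s → out u ≤ x u) → (χ : Fin n → ℕ) → (∀ u → χ u ≤ 1) → χ s ≡ 0 →
    ∀ u → χ u ≤ firings p u
  loaded-stabilization-fires {s} {x} {e} p e-stable loaded χ χ≤1 χs≡0 u with u ≟ s
  ... | yes refl = subst (_≤ _) (sym χs≡0) z≤n
  ... | no u≢s   = ≤-trans (χ≤1 u) (fires u≢s)
    where
    fires : u ≢ s → 0 < firings p u
    fires u≢s with firings p u in idle
    ... | suc _ = s≤s z≤n
    ... | zero  = contradiction (begin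
      out u                      ≤⟨ loaded u u≢s ⟩
      x u                        ≤⟨ m≤m+n _ _ ⟩
      x u + inflow (firings p) u ≡⟨ sym (idle-vertex p idle) ⟩
      e u                        ∎) (<⇒≱ (e-stable u u≢s))
      where open ≤-Reasoning

  recurrent-dhar : ∀ {s c} → Recurrent G s c → (χ : Fin n → ℕ) → (∀ u → χ u ≤ 1) → χ s ≡ 0 →
    ∃ (λ u → χ u ≡ 1) → ∃ λ u → χ u ≡ 1 × inflow χ u ≤ c u
  recurrent-dhar {s} {c} (_ , reachable) χ χ≤1 χs≡0 nonempty with reachable out
  ... | _ , e , (p , e-stable) , e≡c
    with first-to-finish p χ χ≤1
           (loaded-stabilization-fires p e-stable (λ _ _ → m≤m+n _ _) χ χ≤1 χs≡0) nonempty
  ...   | u , χu≡1 , bound = u , χu≡1 , subst (inflow χ u ≤_) (e≡c u u≢s) bound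
    where
    u≢s : u ≢ s
    u≢s refl = contradiction (trans (sym χu≡1) χs≡0) λ ()

  -- Let c be recurrent for sink s₁, let x ≥ c off s₁, and
  -- fire from x each vertex at most once, s₁ included (odometer a).  Then some
  -- unfired vertex is unstable: Dhar's criterion gives an unfired u with
  -- c u ≥ arcs from unfired vertices, and u has received a chip along every
  -- arc from a fired vertex, so it holds at least indeg u = outdeg u chips.
  unfired-unstable : ∀ {s₁ c x a z} → (∀ v → indeg G v ≡ out v) → Recurrent G s₁ c →
    (∀ v → v ≢ s₁ → c v ≤ x v) → Odometer x a z → (∀ u → a u ≤ 1) → a s₁ ≡ 1 →
    ∃ (λ v → a v ≡ 0) → ∃ λ u → a u ≡ 0 × out u ≤ z u
  unfired-unstable {s₁} {c} {x} {a} {z} balanced rc c≤x xaz a≤1 as₁≡1 (v , av≡0)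
    with recurrent-dhar rc (λ u → 1 ∸ a u) (λ u → m∸n≤m 1 (a u)) (cong (1 ∸_) as₁≡1)
           (v , cong (1 ∸_) av≡0)
  ... | u , unfired , dhar = u , au≡0 , (begin
    out u                                        ≡⟨ sym (balanced u) ⟩
    indeg G u                                    ≡⟨ indeg-split a a≤1 u ⟩
    inflow (λ w → 1 ∸ a w) u + inflow a u        ≤⟨ +-monoˡ-≤ (inflow a u) (≤-trans dhar (c≤x u u≢s₁)) ⟩
    x u + inflow a u                             ≡⟨ sym (balance xaz u) ⟩
    z u + a u * out u                            ≡⟨ cong (λ t → z u + t * out u) au≡0 ⟩
    z u + 0                                      ≡⟨ +-identityʳ (z u) ⟩
    z u                                          ∎)
    where
    open ≤-Reasoning
    au≡0 : a u ≡ 0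
    au≡0 = 1∸m≡1⇒m≡0 (a≤1 u) unfired
    u≢s₁ : u ≢ s₁
    u≢s₁ refl = contradiction (trans (sym au≡0) as₁≡1) λ ()

  -- The burning algorithm for sink s₂: from x ≥ c off s₁ with s₁ unstable,
  -- fire s₁ and then repeatedly an unstable unfired vertex other than s₂,
  -- until s₂ is unstable; by the burning step this never gets stuck.
  module _ {s₁ s₂ : Fin n} {c x : Fin n → ℕ} (eulerian : Eulerian G) (rc : Recurrent G s₁ c)
      (s₁≢s₂ : s₁ ≢ s₂) (c≤x : ∀ v → v ≢ s₁ → c v ≤ x v) where

    Burnt : Set
    Burnt = ∃ λ z → Fires G s₂ x z × out s₂ ≤ z s₂

    -- The loop, with odometer a: every vertex fired at most once, s₁ fired,
    -- s₂ not; at most n firings remain (fuel k).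
    burn-from : ∀ k {a z} → Σ {n} (λ _ → 1) ≤ Σ a + k → Fires G s₂ x z → Odometer x a z →
      (∀ u → a u ≤ 1) → a s₁ ≡ 1 → a s₂ ≡ 0 → Burnt
    burn-from k {a} {z} fuel r xaz a≤1 as₁≡1 as₂≡0 with out s₂ ≤? z s₂
    ... | yes s₂-unstable = z , r , s₂-unstable
    ... | no s₂-stable with unfired-unstable (proj₂ eulerian) rc c≤x xaz a≤1 as₁≡1 (s₂ , as₂≡0)
    ...   | u , au≡0 , unstable = continue k fuel
      where
      u≢s₂ : u ≢ s₂
      u≢s₂ refl = s₂-stable unstable
      s₁≢u : s₁ ≢ u
      s₁≢u refl = contradiction (trans (sym au≡0) as₁≡1) λ ()
      burnt≤1 : ∀ w → a w + δ u w ≤ 1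
      burnt≤1 = δ-step (subst (_< 1) (sym au≡0) (s≤s z≤n)) a≤1
      continue : ∀ k → Σ {n} (λ _ → 1) ≤ Σ a + k → Burnt
      continue zero    fuel = ⊥-elim (no-fuel {a = a} {b = λ _ → 1} {v = u} (Σ-mono burnt≤1) fuel)
      continue (suc k) fuel =
        burn-from k (fuel-step {a = a} {b = λ _ → 1} {v = u} fuel)
          (r ++ᶠ fire-step u u≢s₂ unstable done)
          (odometer-trans xaz (odometer-fire unstable)) burnt≤1
          (δ-keeps {a = a} s₁≢u as₁≡1) (δ-keeps {a = a} (u≢s₂ ∘ sym) as₂≡0)

    burn : out s₁ ≤ x s₁ → Burnt
    burn s₁-unstable =
      burn-from (Σ {n} (λ _ → 1)) (m≤n+m _ _) (fire-step s₁ s₁≢s₂ s₁-unstable done)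
        (odometer-fire s₁-unstable) (δ≤1 s₁) (δ-diag s₁) (δ-off (s₁≢s₂ ∘ sym))

  bar-sink : ∀ s₁ c j → bar G s₁ c j s₁ ≡ out s₁ + j
  bar-sink s₁ c j with s₁ ≟ s₁
  ... | yes _     = refl
  ... | no s₁≢s₁ = ⊥-elim (s₁≢s₁ refl)

  bar-off : ∀ {s₁ c j v} → v ≢ s₁ → bar G s₁ c j v ≡ c v
  bar-off {s₁} {v = v} v≢s₁ with v ≟ s₁
  ... | yes v≡s₁ = ⊥-elim (v≢s₁ v≡s₁)
  ... | no _     = refl

  bar-mono : ∀ {s₁ c c' j j'} → (∀ v → v ≢ s₁ → c v ≤ c' v) → j ≤ j' →
    ∀ w → bar G s₁ c j w ≤ bar G s₁ c' j' w
  bar-mono {s₁} c≤c' j≤j' w with w ≟ s₁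
  ... | yes _    = +-monoʳ-≤ (out s₁) j≤j'
  ... | no w≢s₁ = c≤c' w w≢s₁

  beyond-swap : ∀ {s₁ s₂ c j y} → ¬ SwapCond G s₁ s₂ c j → Stabilizes G s₂ (bar G s₁ c j) y →
    out s₂ + j ≤ y s₂ → out s₂ + j < y s₂
  beyond-swap {y = y} no-swap stabilizes ≥ = ≤∧≢⇒< ≥ (λ eq → no-swap (y , stabilizes , sym eq))

  -- The stabilizations exist because
  -- \overline{c}^k lies below x', which stabilizes via q.
  module _ {s₁ s₂ : Fin n} {c x' y' : Fin n → ℕ} (eulerian : Eulerian G) (s₁≢s₂ : s₁ ≢ s₂)
      (rc : Recurrent G s₁ c) (q : Fires G s₂ x' y') (y'-stable : Stable G s₂ y') where

    overshoot : ∀ k → (∀ w → bar G s₁ c k w ≤ x' w) → (∀ j → j ≤ k → ¬ SwapCond G s₁ s₂ c j) →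
      ∃ λ y → Stabilizes G s₂ (bar G s₁ c k) y × out s₂ + k < y s₂
    overshoot zero below no-swap
      with burn eulerian rc s₁≢s₂ (λ v v≢s₁ → ≤-reflexive (sym (bar-off v≢s₁)))
             (≤-reflexive (sym (trans (bar-sink s₁ c 0) (+-identityʳ (out s₁)))))
    ... | z , r , s₂-loaded with LeastAction.stabilize-after below q y'-stable r
    ...   | y , p , y-stable = y , (r ++ᶠ p , y-stable) ,
            beyond-swap (no-swap 0 z≤n) (r ++ᶠ p , y-stable)
              (≤-trans (≤-reflexive (+-identityʳ (out s₂))) (≤-trans s₂-loaded (sink-nondecreasing p)))
    overshoot (suc k) below no-swap
      with overshoot k (λ w → ≤-trans (bar-mono (λ _ _ → ≤-refl) (n≤1+n k) w) (below w))
             (λ j j≤k → no-swap j (m≤n⇒m≤1+n j≤k))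
    ... | yₖ , (pₖ , _) , yₖ-large with LeastAction.stabilize-after below q y'-stable done
    ...   | y , p , y-stable = y , (p , y-stable) ,
            beyond-swap (no-swap (suc k) ≤-refl) (p , y-stable)
              (≤-trans (≤-reflexive (+-suc (out s₂) k))
                (≤-trans yₖ-large (sink-monotone (bar-mono (λ _ _ → ≤-refl) (n≤1+n k)) pₖ p y-stable)))

-- If i' < i, the overshoot lemma for c at i' contradicts the least action
-- principle against the stabilization of \overline{c'}^{i'}.
proposition2 : ∀ {n} (G : Digraph n) → Eulerian G →
    (s₁ s₂ : Fin n) → s₁ ≢ s₂ →
    (c c' : Fin n → ℕ) → Recurrent G s₁ c → Recurrent G s₁ c' →
    (∀ v → v ≢ s₁ → c v ≤ c' v) →
    ∀ i i' → IsSwapNumber G s₁ s₂ c i → IsSwapNumber G s₁ s₂ c' i' → i ≤ i'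
proposition2 G eulerian s₁ s₂ s₁≢s₂ c c' rc _ c≤c' i i' (_ , minimal) ((y' , (q , y'-stable) , y's₂) , _)
  with i ≤? i'
... | yes i≤i' = i≤i'
... | no i≰i'
  with overshoot G eulerian s₁≢s₂ rc q y'-stable i' (bar-mono G c≤c' ≤-refl)
         (λ j j≤i' → minimal j (≤-<-trans j≤i' (≰⇒> i≰i')))
...   | y , (p , _) , overshot =
  contradiction (≤-trans (sink-monotone G (bar-mono G c≤c' ≤-refl) p q y'-stable) (≤-reflexive y's₂))
    (<⇒≱ overshot)
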